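{- For every formula $A$ of first-order intuitionistic predicate logic $\mathrm{PL}$ and every state formula $\alpha$, define the main formula $A_\alpha$ of $\mathrm{SL}$ by $Q_\alpha:=Q$ for $Q$ atomic (including $\top,\bot$), $(A\wedge B)_\alpha:=A_\alpha\wedge B_\alpha$, $(A\vee B)_\alpha:=A_\alpha\vee B_\alpha$, $(\exists xA)_\alpha:=\exists xA_\alpha$, $(A\to B)_\alpha:=A_\alpha\Rightarrow\{\alpha\}B_\alpha\{\alpha\}$, $(\forall xA)_\alpha:=\forall x\{\alpha\}A_\alpha\{\alpha\}$. If $A_1,\ldots,A_n\vdash_I A$ is provable in $\mathrm{PL}$, then $(A_1)_\alpha,\ldots,(A_n)_\alpha,\Delta\vdash_S\{\alpha\}A_\alpha\{\alpha\}$ is derivable in $\mathrm{SL}$, for any finite set $\Delta$ of main formulas.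
   Context: $\mathrm{PL}$ is ordinary intuitionistic first-order natural deduction (sequents $\Gamma\vdash_IA$) over a signature of function symbols and ordinary predicate symbols. $\mathrm{SL}$ is over the same signature extended by state predicate symbols. State formulas: $\top,\bot,p(\vec t)$ ($p$ a state predicate), closed under $\wedge,\vee,\to$. Main formulas: $\top,\bot,P(\vec t)$, $A\wedge B$, $A\vee B$, $\exists xA$, $A\Rightarrow\{\alpha\}B\{\beta\}$, $\forall x\{\alpha\}A\{\beta\}$. State sequents $\Gamma\vdash_H\alpha$: classical propositional natural deduction. Main sequents $\Gamma\vdash_S\{\alpha\}A\{\beta\}$ generated by: $\Gamma\vdash_S\{\alpha\}A\{\alpha\}$ if $A\in\Gamma$; $\Gamma\vdash_S\{\alpha\}\top\{\alpha\}$; from $\{\alpha\}A\{\beta\},\{\beta\}B\{\gamma\}$ infer $\{\alpha\}A\wedge B\{\gamma\}$; from $\{\alpha\}A\wedge B\{\beta\}$ infer $\{\alpha\}A\{\beta\}$ and $\{\alpha\}B\{\beta\}$; from $\{\alpha\}A\{\beta\}$ (resp. $B$) infer $\{\alpha\}A\vee B\{\beta\}$; from $\Gamma\vdash_S\{\alpha\}A\vee B\{\beta\}$, $\Gamma,A\vdash_S\{\beta\}C\{\gamma\}$, $\Gamma,B\vdash_S\{\beta\}C\{\gamma\}$ infer $\Gamma\vdash_S\{\alpha\}C\{\gamma\}$; from $\Gamma,A\vdash_S\{\alpha\}B\{\beta\}$ infer $\Gamma\vdash_S\{\gamma\}(A\Rightarrow\{\alpha\}B\{\beta\})\{\gamma\}$;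 from $\{\alpha\}(A\Rightarrow\{\gamma\}B\{\delta\})\{\beta\}$, $\{\beta\}A\{\gamma\}$ infer $\{\alpha\}B\{\delta\}$; from $\{\alpha\}\bot\{\beta\}$ infer $\{\alpha\}A\{\gamma\}$; from $\Gamma\vdash_S\{\alpha[y/x]\}A[y/x]\{\beta[y/x]\}$ infer $\Gamma\vdash_S\{\gamma\}\forall x\{\alpha\}A\{\beta\}\{\gamma\}$ ($y\equiv x$ or $y$ not free in $A,\alpha,\beta$; $y$ not free in $\Gamma$); from $\{\alpha\}\forall x\{\beta\}A\{\gamma\}\{\beta[t/x]\}$ infer $\{\alpha\}A[t/x]\{\gamma[t/x]\}$; from $\{\alpha\}A[t/x]\{\beta\}$ infer $\{\alpha\}\exists xA\{\beta\}$; from $\Gamma\vdash_S\{\alpha\}\exists xA\{\beta\}$, $\Gamma,A[y/x]\vdash_S\{\beta\}C\{\gamma\}$ infer $\Gamma\vdash_S\{\alpha\}C\{\gamma\}$ ($y\equiv x$ or $y$ not free in $A$; $y$ not free in $C,\alpha,\beta,\gamma,\Gamma$); (cons) from $\alpha\vdash_H\beta$, $\Gamma\vdash_S\{\beta\}A\{\gamma\}$, $\gamma\vdash_H\delta$ infer $\Gamma\vdash_S\{\alpha\}A\{\delta\}$; (cond) from $\vdash_H\alpha\vee\beta$, $\Gamma\vdash_S\{\alpha\wedge\gamma\}A\{\delta\}$, $\Gamma\vdash_S\{\beta\wedge\gamma\}A\{\delta\}$ infer $\Gamma\vdash_S\{\gamma\}A\{\delta\}$. -}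

module Defs where

open import Data.Nat using (ℕ; zero; suc)
open import Data.Fin using (Fin; zero; suc)
open import Data.Vec using (Vec; []; _∷_)
open import Data.List using (List; []; _∷_; map)
open import Data.List.Membership.Propositional using (_∈_)

-- Signature: function symbols, ordinary predicate symbols (shared by PL
-- and SL) and state predicate symbols (SL only), each with an arity.

record Signature : Set₁ where
  field
    Fun    : Set
    farity : Fun → ℕ
    Pred   : Set
    parity : Pred → ℕ
    SPred  : Set
    sarity : SPred → ℕ

-- Syntax, well-scoped de Bruijn: `X n` has free variables among Fin n.

module _ (S : Signature) where
  open Signature S

  data Term (n : ℕ) : Set where
    var : Fin n → Term n
    fn  : (f : Fun) → Vec (Term n) (farity f) → Term n

  data Formula (n : ℕ) : Set where
    ⊤ᶠ ⊥ᶠ : Formula n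
    predᶠ : (P : Pred) → Vec (Term n) (parity P) → Formula n
    _∧ᶠ_ _∨ᶠ_ _→ᶠ_ : Formula n → Formula n → Formula n
    ∀ᶠ ∃ᶠ : Formula (suc n) → Formula n

  data State (n : ℕ) : Set where
    ⊤ˢ ⊥ˢ : State n
    spred : (p : SPred) → Vec (Term n) (sarity p) → State n
    _∧ˢ_ _∨ˢ_ _→ˢ_ : State n → State n → State n

  data Main (n : ℕ) : Set where
    ⊤ᵐ ⊥ᵐ : Main n
    predᵐ : (P : Pred) → Vec (Term n) (parity P) → Main n
    _∧ᵐ_ _∨ᵐ_ : Main n → Main n → Main n
    ∃ᵐ : Main (suc n) → Main n
    -- A ⇒ {α} B {β}
    imp : Main n → State n → Main n → State n → Main n
    -- ∀x {α} A {β}   (x bound in α, A, β)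
    all : State (suc n) → Main (suc n) → State (suc n) → Main n

  Ren : ℕ → ℕ → Set
  Ren n m = Fin n → Fin m

  liftR : ∀ {n m} → Ren n m → Ren (suc n) (suc m)
  liftR ρ zero    = zero
  liftR ρ (suc i) = suc (ρ i)

  mutual
    renT : ∀ {n m} → Ren n m → Term n → Term m
    renT ρ (var i)   = var (ρ i)
    renT ρ (fn f ts) = fn f (renTs ρ ts)

    renTs : ∀ {n m k} → Ren n m → Vec (Term n) k → Vec (Term m) k
    renTs ρ []       = []
    renTs ρ (t ∷ ts) = renT ρ t ∷ renTs ρ ts

  Sub : ℕ → ℕ → Set
  Sub n m = Fin n → Term m

  liftS : ∀ {n m} → Sub n m → Sub (suc n) (suc m)
  liftS σ zero    = var zero
  liftS σ (suc i) = renT suc (σ i)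

  mutual
    subT : ∀ {n m} → Sub n m → Term n → Term m
    subT σ (var i)   = σ i
    subT σ (fn f ts) = fn f (subTs σ ts)

    subTs : ∀ {n m k} → Sub n m → Vec (Term n) k → Vec (Term m) k
    subTs σ []       = []
    subTs σ (t ∷ ts) = subT σ t ∷ subTs σ ts

  subF : ∀ {n m} → Sub n m → Formula n → Formula m
  subF σ ⊤ᶠ = ⊤ᶠ
  subF σ ⊥ᶠ = ⊥ᶠ
  subF σ (predᶠ P ts) = predᶠ P (subTs σ ts)
  subF σ (A ∧ᶠ B) = subF σ A ∧ᶠ subF σ B
  subF σ (A ∨ᶠ B) = subF σ A ∨ᶠ subF σ B
  subF σ (A →ᶠ B) = subF σ A →ᶠ subF σ B
  subF σ (∀ᶠ A) = ∀ᶠ (subF (liftS σ) A)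
  subF σ (∃ᶠ A) = ∃ᶠ (subF (liftS σ) A)

  subSt : ∀ {n m} → Sub n m → State n → State m
  subSt σ ⊤ˢ = ⊤ˢ
  subSt σ ⊥ˢ = ⊥ˢ
  subSt σ (spred p ts) = spred p (subTs σ ts)
  subSt σ (α ∧ˢ β) = subSt σ α ∧ˢ subSt σ β
  subSt σ (α ∨ˢ β) = subSt σ α ∨ˢ subSt σ β
  subSt σ (α →ˢ β) = subSt σ α →ˢ subSt σ β

  subM : ∀ {n m} → Sub n m → Main n → Main m
  subM σ ⊤ᵐ = ⊤ᵐ
  subM σ ⊥ᵐ = ⊥ᵐ
  subM σ (predᵐ P ts) = predᵐ P (subTs σ ts)
  subM σ (A ∧ᵐ B) = subM σ A ∧ᵐ subM σ B
  subM σ (A ∨ᵐ B) = subM σ A ∨ᵐ subM σ B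
  subM σ (∃ᵐ A) = ∃ᵐ (subM (liftS σ) A)
  subM σ (imp A α B β) = imp (subM σ A) (subSt σ α) (subM σ B) (subSt σ β)
  subM σ (all α A β) = all (subSt (liftS σ) α) (subM (liftS σ) A) (subSt (liftS σ) β)

  wk : ∀ {n} → Sub n (suc n)
  wk i = var (suc i)

  sub0 : ∀ {n} → Term n → Sub (suc n) n
  sub0 t zero    = t
  sub0 t (suc i) = var i

  infix 4 _⊢I_
  data _⊢I_ {n : ℕ} : List (Formula n) → Formula n → Set where
    ax   : ∀ {Γ A} → A ∈ Γ → Γ ⊢I A
    ⊤I   : ∀ {Γ} → Γ ⊢I ⊤ᶠ
    ⊥E   : ∀ {Γ A} → Γ ⊢I ⊥ᶠ → Γ ⊢I A
    ∧I   : ∀ {Γ A B} → Γ ⊢I A → Γ ⊢I B → Γ ⊢I A ∧ᶠ B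
    ∧E₁  : ∀ {Γ A B} → Γ ⊢I A ∧ᶠ B → Γ ⊢I A
    ∧E₂  : ∀ {Γ A B} → Γ ⊢I A ∧ᶠ B → Γ ⊢I B
    ∨I₁  : ∀ {Γ A B} → Γ ⊢I A → Γ ⊢I A ∨ᶠ B
    ∨I₂  : ∀ {Γ A B} → Γ ⊢I B → Γ ⊢I A ∨ᶠ B
    ∨E   : ∀ {Γ A B C} → Γ ⊢I A ∨ᶠ B → (A ∷ Γ) ⊢I C → (B ∷ Γ) ⊢I C → Γ ⊢I C
    →I   : ∀ {Γ A B} → (A ∷ Γ) ⊢I B → Γ ⊢I A →ᶠ B
    →E   : ∀ {Γ A B} → Γ ⊢I A →ᶠ B → Γ ⊢I A → Γ ⊢I B
    ∀I   : ∀ {Γ A} → map (subF wk) Γ ⊢I A → Γ ⊢I ∀ᶠ A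
    ∀E   : ∀ {Γ A} (t : Term n) → Γ ⊢I ∀ᶠ A → Γ ⊢I subF (sub0 t) A
    ∃I   : ∀ {Γ A} (t : Term n) → Γ ⊢I subF (sub0 t) A → Γ ⊢I ∃ᶠ A
    ∃E   : ∀ {Γ A C} → Γ ⊢I ∃ᶠ A → (A ∷ map (subF wk) Γ) ⊢I subF wk C → Γ ⊢I C

  -- State sequents Γ ⊢H α : classical propositional natural deduction
  -- (atoms p(t⃗) treated as propositional atoms)

  infix 4 _⊢H_
  data _⊢H_ {n : ℕ} : List (State n) → State n → Set where
    ax   : ∀ {Γ α} → α ∈ Γ → Γ ⊢H α
    ⊤I   : ∀ {Γ} → Γ ⊢H ⊤ˢ
    ⊥E   : ∀ {Γ α} → Γ ⊢H ⊥ˢ → Γ ⊢H α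
    ∧I   : ∀ {Γ α β} → Γ ⊢H α → Γ ⊢H β → Γ ⊢H α ∧ˢ β
    ∧E₁  : ∀ {Γ α β} → Γ ⊢H α ∧ˢ β → Γ ⊢H α
    ∧E₂  : ∀ {Γ α β} → Γ ⊢H α ∧ˢ β → Γ ⊢H β
    ∨I₁  : ∀ {Γ α β} → Γ ⊢H α → Γ ⊢H α ∨ˢ β
    ∨I₂  : ∀ {Γ α β} → Γ ⊢H β → Γ ⊢H α ∨ˢ β
    ∨E   : ∀ {Γ α β γ} → Γ ⊢H α ∨ˢ β → (α ∷ Γ) ⊢H γ → (β ∷ Γ) ⊢H γ → Γ ⊢H γ
    →I   : ∀ {Γ α β} → (α ∷ Γ) ⊢H β → Γ ⊢H α →ˢ β
    →E   : ∀ {Γ α β} → Γ ⊢H α →ˢ β → Γ ⊢H α → Γ ⊢H β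
    raa  : ∀ {Γ α} → ((α →ˢ ⊥ˢ) ∷ Γ) ⊢H ⊥ˢ → Γ ⊢H α

  -- SL main sequents  Γ ⊢S[ α ] A [ β ]   (i.e. Γ ⊢_S {α} A {β})

  infix 4 _⊢S[_]_[_]
  data _⊢S[_]_[_] {n : ℕ} : List (Main n) → State n → Main n → State n → Set where
    ax   : ∀ {Γ α A} → A ∈ Γ → Γ ⊢S[ α ] A [ α ]
    ⊤I   : ∀ {Γ α} → Γ ⊢S[ α ] ⊤ᵐ [ α ]
    ∧I   : ∀ {Γ α β γ A B} → Γ ⊢S[ α ] A [ β ] → Γ ⊢S[ β ] B [ γ ] → Γ ⊢S[ α ] A ∧ᵐ B [ γ ]
    ∧E₁  : ∀ {Γ α β A B} → Γ ⊢S[ α ] A ∧ᵐ B [ β ] → Γ ⊢S[ α ] A [ β ]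
    ∧E₂  : ∀ {Γ α β A B} → Γ ⊢S[ α ] A ∧ᵐ B [ β ] → Γ ⊢S[ α ] B [ β ]
    ∨I₁  : ∀ {Γ α β A B} → Γ ⊢S[ α ] A [ β ] → Γ ⊢S[ α ] A ∨ᵐ B [ β ]
    ∨I₂  : ∀ {Γ α β A B} → Γ ⊢S[ α ] B [ β ] → Γ ⊢S[ α ] A ∨ᵐ B [ β ]
    ∨E   : ∀ {Γ α β γ A B C} → Γ ⊢S[ α ] A ∨ᵐ B [ β ] →
             (A ∷ Γ) ⊢S[ β ] C [ γ ] → (B ∷ Γ) ⊢S[ β ] C [ γ ] → Γ ⊢S[ α ] C [ γ ]
    ⇒I   : ∀ {Γ α β γ A B} → (A ∷ Γ) ⊢S[ α ] B [ β ] → Γ ⊢S[ γ ] imp A α B β [ γ ]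
    ⇒E   : ∀ {Γ α β γ δ A B} → Γ ⊢S[ α ] imp A γ B δ [ β ] → Γ ⊢S[ β ] A [ γ ] →
             Γ ⊢S[ α ] B [ δ ]
    ⊥E   : ∀ {Γ α β γ A} → Γ ⊢S[ α ] ⊥ᵐ [ β ] → Γ ⊢S[ α ] A [ γ ]
    ∀I   : ∀ {Γ α β γ A} → map (subM wk) Γ ⊢S[ α ] A [ β ] → Γ ⊢S[ γ ] all α A β [ γ ]
    ∀E   : ∀ {Γ α β γ A} (t : Term n) → Γ ⊢S[ α ] all β A γ [ subSt (sub0 t) β ] →
             Γ ⊢S[ α ] subM (sub0 t) A [ subSt (sub0 t) γ ]
    ∃I   : ∀ {Γ α β A} (t : Term n) → Γ ⊢S[ α ] subM (sub0 t) A [ β ] → Γ ⊢S[ α ] ∃ᵐ A [ β ]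
    ∃E   : ∀ {Γ α β γ A C} → Γ ⊢S[ α ] ∃ᵐ A [ β ] →
             (A ∷ map (subM wk) Γ) ⊢S[ subSt wk β ] subM wk C [ subSt wk γ ] →
             Γ ⊢S[ α ] C [ γ ]
    cons : ∀ {Γ α β γ δ A} → (α ∷ []) ⊢H β → Γ ⊢S[ β ] A [ γ ] → (γ ∷ []) ⊢H δ →
             Γ ⊢S[ α ] A [ δ ]
    cond : ∀ {Γ α β γ δ A} → [] ⊢H α ∨ˢ β → Γ ⊢S[ α ∧ˢ γ ] A [ δ ] →
             Γ ⊢S[ β ∧ˢ γ ] A [ δ ] → Γ ⊢S[ γ ] A [ δ ]

  tr : ∀ {n} → State n → Formula n → Main n
  tr α ⊤ᶠ = ⊤ᵐ
  tr α ⊥ᶠ = ⊥ᵐ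
  tr α (predᶠ P ts) = predᵐ P ts
  tr α (A ∧ᶠ B) = tr α A ∧ᵐ tr α B
  tr α (A ∨ᶠ B) = tr α A ∨ᵐ tr α B
  tr α (A →ᶠ B) = imp (tr α A) α (tr α B) α
  tr α (∀ᶠ A) = all (subSt wk α) (tr (subSt wk α) A) (subSt wk α)
  tr α (∃ᶠ A) = ∃ᵐ (tr (subSt wk α) A)

{-# OPTIONS --safe #-}
-- The translation commutes with substitution, and under a binder it uses the
-- weakened state, which the instantiation [t/x] turns back into α. Hence every
-- rule of PL maps to the SL rule of the same name, with all pre- and
-- postconditions equal to α, by induction on the PL derivation.
module Submission where

open import Defs
open import Data.Nat using (ℕ)
open import Data.Fin using (suc)
open import Data.Vec using (Vec; []; _∷_)
open import Data.List using (List; map; _++_; _∷_)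
open import Data.List.Properties using (map-++; map-cong; map-∘)
open import Data.List.Membership.Propositional.Properties using (∈-map⁺; ∈-++⁺ˡ)
open import Relation.Binary.PropositionalEquality

module _ (S : Signature) where

  mutual
    subT-cong : ∀ {n m} {σ τ : Sub S n m} → (∀ i → σ i ≡ τ i) →
      (t : Term S n) → subT S σ t ≡ subT S τ t
    subT-cong σ≗τ (var i)   = σ≗τ i
    subT-cong σ≗τ (fn f ts) = cong (fn f) (subTs-cong σ≗τ ts)

    subTs-cong : ∀ {n m k} {σ τ : Sub S n m} → (∀ i → σ i ≡ τ i) →
      (ts : Vec (Term S n) k) → subTs S σ ts ≡ subTs S τ ts
    subTs-cong σ≗τ []       = refl
    subTs-cong σ≗τ (t ∷ ts) = cong₂ _∷_ (subT-cong σ≗τ t) (subTs-cong σ≗τ ts)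

  mutual
    subT-∘ : ∀ {n m k} (σ : Sub S m k) (τ : Sub S n m) (t : Term S n) →
      subT S σ (subT S τ t) ≡ subT S (λ i → subT S σ (τ i)) t
    subT-∘ σ τ (var i)   = refl
    subT-∘ σ τ (fn f ts) = cong (fn f) (subTs-∘ σ τ ts)

    subTs-∘ : ∀ {n m k j} (σ : Sub S m k) (τ : Sub S n m) (ts : Vec (Term S n) j) →
      subTs S σ (subTs S τ ts) ≡ subTs S (λ i → subT S σ (τ i)) ts
    subTs-∘ σ τ []       = refl
    subTs-∘ σ τ (t ∷ ts) = cong₂ _∷_ (subT-∘ σ τ t) (subTs-∘ σ τ ts)

  mutual
    subT-var : ∀ {n m} (ρ : Ren S n m) (t : Term S n) →
      subT S (λ i → var (ρ i)) t ≡ renT S ρ t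
    subT-var ρ (var i)   = refl
    subT-var ρ (fn f ts) = cong (fn f) (subTs-var ρ ts)

    subTs-var : ∀ {n m k} (ρ : Ren S n m) (ts : Vec (Term S n) k) →
      subTs S (λ i → var (ρ i)) ts ≡ renTs S ρ ts
    subTs-var ρ []       = refl
    subTs-var ρ (t ∷ ts) = cong₂ _∷_ (subT-var ρ t) (subTs-var ρ ts)

  mutual
    subT-id : ∀ {n} (t : Term S n) → subT S var t ≡ t
    subT-id (var i)   = refl
    subT-id (fn f ts) = cong (fn f) (subTs-id ts)

    subTs-id : ∀ {n k} (ts : Vec (Term S n) k) → subTs S var ts ≡ ts
    subTs-id []       = refl
    subTs-id (t ∷ ts) = cong₂ _∷_ (subT-id t) (subTs-id ts)

  subSt-cong : ∀ {n m} {σ τ : Sub S n m} → (∀ i → σ i ≡ τ i) →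
    (α : State S n) → subSt S σ α ≡ subSt S τ α
  subSt-cong σ≗τ ⊤ˢ           = refl
  subSt-cong σ≗τ ⊥ˢ           = refl
  subSt-cong σ≗τ (spred p ts) = cong (spred p) (subTs-cong σ≗τ ts)
  subSt-cong σ≗τ (α ∧ˢ β)     = cong₂ _∧ˢ_ (subSt-cong σ≗τ α) (subSt-cong σ≗τ β)
  subSt-cong σ≗τ (α ∨ˢ β)     = cong₂ _∨ˢ_ (subSt-cong σ≗τ α) (subSt-cong σ≗τ β)
  subSt-cong σ≗τ (α →ˢ β)     = cong₂ _→ˢ_ (subSt-cong σ≗τ α) (subSt-cong σ≗τ β)

  subSt-∘ : ∀ {n m k} (σ : Sub S m k) (τ : Sub S n m) (α : State S n) →
    subSt S σ (subSt S τ α) ≡ subSt S (λ i → subT S σ (τ i)) α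
  subSt-∘ σ τ ⊤ˢ           = refl
  subSt-∘ σ τ ⊥ˢ           = refl
  subSt-∘ σ τ (spred p ts) = cong (spred p) (subTs-∘ σ τ ts)
  subSt-∘ σ τ (α ∧ˢ β)     = cong₂ _∧ˢ_ (subSt-∘ σ τ α) (subSt-∘ σ τ β)
  subSt-∘ σ τ (α ∨ˢ β)     = cong₂ _∨ˢ_ (subSt-∘ σ τ α) (subSt-∘ σ τ β)
  subSt-∘ σ τ (α →ˢ β)     = cong₂ _→ˢ_ (subSt-∘ σ τ α) (subSt-∘ σ τ β)

  subSt-id : ∀ {n} (α : State S n) → subSt S var α ≡ α
  subSt-id ⊤ˢ           = refl
  subSt-id ⊥ˢ           = refl
  subSt-id (spred p ts) = cong (spred p) (subTs-id ts)
  subSt-id (α ∧ˢ β)     = cong₂ _∧ˢ_ (subSt-id α) (subSt-id β)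
  subSt-id (α ∨ˢ β)     = cong₂ _∨ˢ_ (subSt-id α) (subSt-id β)
  subSt-id (α →ˢ β)     = cong₂ _→ˢ_ (subSt-id α) (subSt-id β)

  subSt-liftS-wk : ∀ {n m} (σ : Sub S n m) (α : State S n) →
    subSt S (liftS S σ) (subSt S (wk S) α) ≡ subSt S (wk S) (subSt S σ α)
  subSt-liftS-wk σ α = begin
    subSt S (liftS S σ) (subSt S (wk S) α)       ≡⟨ subSt-∘ (liftS S σ) (wk S) α ⟩
    subSt S (λ i → renT S suc (σ i)) α           ≡⟨ subSt-cong (λ i → sym (subT-var suc (σ i))) α ⟩
    subSt S (λ i → subT S (wk S) (σ i)) α        ≡⟨ sym (subSt-∘ (wk S) σ α) ⟩
    subSt S (wk S) (subSt S σ α)                 ∎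
    where open ≡-Reasoning

  subSt-sub0-wk : ∀ {n} (t : Term S n) (α : State S n) →
    subSt S (sub0 S t) (subSt S (wk S) α) ≡ α
  subSt-sub0-wk t α = trans (subSt-∘ (sub0 S t) (wk S) α) (subSt-id α)

  subM-tr : ∀ {n m} (σ : Sub S n m) (α : State S n) (A : Formula S n) →
    subM S σ (tr S α A) ≡ tr S (subSt S σ α) (subF S σ A)
  subM-tr σ α ⊤ᶠ           = refl
  subM-tr σ α ⊥ᶠ           = refl
  subM-tr σ α (predᶠ P ts) = refl
  subM-tr σ α (A ∧ᶠ B)     = cong₂ _∧ᵐ_ (subM-tr σ α A) (subM-tr σ α B)
  subM-tr σ α (A ∨ᶠ B)     = cong₂ _∨ᵐ_ (subM-tr σ α A) (subM-tr σ α B)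
  subM-tr σ α (A →ᶠ B)     =
    cong₂ (λ A′ B′ → imp A′ (subSt S σ α) B′ (subSt S σ α)) (subM-tr σ α A) (subM-tr σ α B)
  subM-tr σ α (∀ᶠ A)
    rewrite subM-tr (liftS S σ) (subSt S (wk S) α) A | subSt-liftS-wk σ α = refl
  subM-tr σ α (∃ᶠ A)
    rewrite subM-tr (liftS S σ) (subSt S (wk S) α) A | subSt-liftS-wk σ α = refl

  subM-sub0-tr-wk : ∀ {n} (t : Term S n) (α : State S n) (A : Formula S (ℕ.suc n)) →
    subM S (sub0 S t) (tr S (subSt S (wk S) α) A) ≡ tr S α (subF S (sub0 S t) A)
  subM-sub0-tr-wk t α A = begin
    subM S (sub0 S t) (tr S (subSt S (wk S) α) A)
      ≡⟨ subM-tr (sub0 S t) (subSt S (wk S) α) A ⟩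
    tr S (subSt S (sub0 S t) (subSt S (wk S) α)) (subF S (sub0 S t) A)
      ≡⟨ cong (λ β → tr S β (subF S (sub0 S t) A)) (subSt-sub0-wk t α) ⟩
    tr S α (subF S (sub0 S t) A)
      ∎
    where open ≡-Reasoning

  map-subM-wk-tr : ∀ {n} (α : State S n) (Γ : List (Formula S n)) (Δ : List (Main S n)) →
    map (subM S (wk S)) (map (tr S α) Γ ++ Δ) ≡
    map (tr S (subSt S (wk S) α)) (map (subF S (wk S)) Γ) ++ map (subM S (wk S)) Δ
  map-subM-wk-tr α Γ Δ = begin
    map (subM S (wk S)) (map (tr S α) Γ ++ Δ)
      ≡⟨ map-++ (subM S (wk S)) (map (tr S α) Γ) Δ ⟩
    map (subM S (wk S)) (map (tr S α) Γ) ++ map (subM S (wk S)) Δ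
      ≡⟨ cong (_++ map (subM S (wk S)) Δ) translated-context ⟩
    map (tr S (subSt S (wk S) α)) (map (subF S (wk S)) Γ) ++ map (subM S (wk S)) Δ
      ∎
    where
    open ≡-Reasoning
    translated-context : map (subM S (wk S)) (map (tr S α) Γ)
                       ≡ map (tr S (subSt S (wk S) α)) (map (subF S (wk S)) Γ)
    translated-context = trans (sym (map-∘ Γ)) (trans (map-cong (subM-tr (wk S) α) Γ) (map-∘ Γ))

  tr-⊢S : ∀ {n} {Γ : List (Formula S n)} {A : Formula S n} (α : State S n) (Δ : List (Main S n)) →
    _⊢I_ S Γ A → _⊢S[_]_[_] S (map (tr S α) Γ ++ Δ) α (tr S α A) α
  tr-⊢S α Δ (ax A∈Γ)   = ax (∈-++⁺ˡ (∈-map⁺ (tr S α) A∈Γ))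
  tr-⊢S α Δ ⊤I         = ⊤I
  tr-⊢S α Δ (⊥E d)     = ⊥E (tr-⊢S α Δ d)
  tr-⊢S α Δ (∧I d e)   = ∧I (tr-⊢S α Δ d) (tr-⊢S α Δ e)
  tr-⊢S α Δ (∧E₁ d)    = ∧E₁ (tr-⊢S α Δ d)
  tr-⊢S α Δ (∧E₂ d)    = ∧E₂ (tr-⊢S α Δ d)
  tr-⊢S α Δ (∨I₁ d)    = ∨I₁ (tr-⊢S α Δ d)
  tr-⊢S α Δ (∨I₂ d)    = ∨I₂ (tr-⊢S α Δ d)
  tr-⊢S α Δ (∨E d e f) = ∨E (tr-⊢S α Δ d) (tr-⊢S α Δ e) (tr-⊢S α Δ f)
  tr-⊢S α Δ (→I d)     = ⇒I (tr-⊢S α Δ d)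
  tr-⊢S α Δ (→E d e)   = ⇒E (tr-⊢S α Δ d) (tr-⊢S α Δ e)
  tr-⊢S {Γ = Γ} α Δ (∀I d) =
    ∀I (subst (λ Θ → _⊢S[_]_[_] S Θ _ _ _) (sym (map-subM-wk-tr α Γ Δ))
              (tr-⊢S (subSt S (wk S) α) (map (subM S (wk S)) Δ) d))
  tr-⊢S α Δ (∀E {A = A} t d) =
    subst₂ (_⊢S[_]_[_] S _ α) (subM-sub0-tr-wk t α A) (subSt-sub0-wk t α)
      (∀E t (subst (_⊢S[_]_[_] S _ α _) (sym (subSt-sub0-wk t α)) (tr-⊢S α Δ d)))
  tr-⊢S α Δ (∃I {A = A} t d) =
    ∃I t (subst (λ B → _⊢S[_]_[_] S _ α B α) (sym (subM-sub0-tr-wk t α A)) (tr-⊢S α Δ d))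
  tr-⊢S {Γ = Γ} α Δ (∃E {A = A} {C = C} d e) =
    ∃E (tr-⊢S α Δ d)
      (subst₂ (λ Θ B → _⊢S[_]_[_] S (tr S (subSt S (wk S) α) A ∷ Θ) _ B _)
        (sym (map-subM-wk-tr α Γ Δ)) (sym (subM-tr (wk S) α C))
        (tr-⊢S (subSt S (wk S) α) (map (subM S (wk S)) Δ) e))

proposition2p1 : (S : Signature) {n : ℕ} (Γ : List (Formula S n)) (A : Formula S n)
    (α : State S n) (Δ : List (Main S n)) →
    _⊢I_ S Γ A →
    _⊢S[_]_[_] S (map (tr S α) Γ ++ Δ) α (tr S α A) α
proposition2p1 S Γ A α Δ = tr-⊢S S α Δ
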